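{- For all integers $t\ge 2$ and $q\ge t$, $p_t^*(t,q)\le g_t^*(q)\le p_t(t,q)$.
   Context: A $PHF(N;n,q,t)$ is an $N\times n$ matrix over $[q]$ such that for every set of $t$ columns there is a row in which these $t$ columns have pairwise distinct entries; $p_t(N,q)$ is the maximum such $n$. A column $x$ has a unique coordinate $i$ if $y(i)\ne x(i)$ for every other column $y$; a $PHF^*(N;n,q,t)$ is a $PHF(N;n,q,t)$ with no column having a unique coordinate, and $p_t^*(N,q)$ is the maximum such $n$. A hypergraph is linear if any two distinct edges share at most one vertex. An $r$-uniform $r$-partite hypergraph with equal part size $q$ has vertex set partitioned into $r$ parts of size $q$, each edge meeting each part in exactly one vertex. A (Berge) cycle of length $k\ge 2$ is a sequence $v_1,E_1,v_2,E_2,\dots,v_k,E_k,v_1$ with distinct vertices $v_i$, distinct edges $E_i$, $v_i,v_{i+1}\in E_i$ for $1\le i\le k-1$ and $v_k,v_1\in E_k$; it is a rainbow cycle if $v_1,\dots,v_k$ lie in pairwise different parts. $g_r^*(q)$ is the maximum number of edges of an $r$-uniform $r$-partite linear hypergraph with equal part size $q$ containing no rainbow cycle. -}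

module Defs where

open import Data.Nat using (ℕ; zero; suc; _≤_)
open import Data.Nat.DivMod using (_%_; m%n<n)
open import Data.Fin using (Fin; toℕ; fromℕ<)
open import Data.Product using (Σ; ∃; ∃-syntax; _×_; _,_; proj₁; proj₂)
open import Relation.Binary.PropositionalEquality using (_≡_; _≢_)
open import Relation.Nullary using (¬_)
open import Function.Definitions using (Injective)

Matrix : ℕ → ℕ → ℕ → Set
Matrix N n q = Fin N → Fin n → Fin q

-- PHF(N;n,q,t): every t-set of columns (given as an injective map Fin t → Fin n)
-- is separated (pairwise distinct entries) in some row.
IsPHF : ∀ {N n q} → ℕ → Matrix N n q → Set
IsPHF {N} {n} t M =
  (c : Fin t → Fin n) → Injective _≡_ _≡_ c →
  ∃[ i ] Injective _≡_ _≡_ (λ j → M i (c j))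

UniqueCoord : ∀ {N n q} → Matrix N n q → Fin n → Fin N → Set
UniqueCoord {n = n} M x i = (y : Fin n) → y ≢ x → M i y ≢ M i x

IsPHF* : ∀ {N n q} → ℕ → Matrix N n q → Set
IsPHF* {N} {n} t M = IsPHF t M × ¬ (Σ (Fin n) λ x → Σ (Fin N) λ i → UniqueCoord M x i)

-- An r-uniform r-partite hypergraph with parts of size q and m edges.
-- Vertices are pairs (j , x) : Fin r × Fin q (part j, element x); an edge meets
-- each part in exactly one vertex, so it is a function Fin r → Fin q.
-- Edges form a set, so the edge map is injective (see IsHypergraph).
Hypergraph : ℕ → ℕ → ℕ → Set
Hypergraph r q m = Fin m → (Fin r → Fin q)

Vertex : ℕ → ℕ → Set
Vertex r q = Fin r × Fin q

_∈E_ : ∀ {r q} → Vertex r q → (Fin r → Fin q) → Set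
(j , x) ∈E e = e j ≡ x

IsHypergraph : ∀ {r q m} → Hypergraph r q m → Set
IsHypergraph E = Injective _≡_ _≡_ E

IsLinear : ∀ {r q m} → Hypergraph r q m → Set
IsLinear {r} {q} {m} E = (a b : Fin m) → a ≢ b → (u w : Vertex r q) →
  u ∈E E a → u ∈E E b → w ∈E E a → w ∈E E b → u ≡ w

next : ∀ {k} → Fin (suc k) → Fin (suc k)
next {k} i = fromℕ< (m%n<n (suc (toℕ i)) (suc k))

-- A rainbow Berge cycle of length 2 + l: distinct vertices v, distinct edges e,
-- v i , v (i+1 mod k) ∈ e i, vertices in pairwise different parts.
RainbowCycle : ∀ {r q m} → Hypergraph r q m → ℕ → Set
RainbowCycle {r} {q} {m} E l =
  Σ (Fin (suc (suc l)) → Vertex r q) λ v →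
  Σ (Fin (suc (suc l)) → Fin m) λ e →
    Injective _≡_ _≡_ v × Injective _≡_ _≡_ e ×
    ((i : Fin (suc (suc l))) → (v i ∈E E (e i)) × (v (next i) ∈E E (e i))) ×
    Injective _≡_ _≡_ (λ i → proj₁ (v i))

HasRainbowCycle : ∀ {r q m} → Hypergraph r q m → Set
HasRainbowCycle E = ∃[ l ] RainbowCycle E l

IsG* : ∀ {r q m} → Hypergraph r q m → Set
IsG* E = IsHypergraph E × IsLinear E × ¬ HasRainbowCycle E

module Submission where

-- A t × n matrix M over [q] is the same as a t-partite hypergraph with parts of
-- size q and n edges: column a is the edge meeting part i in the vertex M i a.
-- First inequality: if M is a PHF* with t ≤ n, a rainbow cycle among its columns
-- would give one column per row such that the chosen columns collide in every
-- row (rows met by the cycle use the two cycle edges through the vertex there,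
-- other rows a partner of a fixed cycle edge, which exists as no coordinate is
-- unique), whereas a PHF separates any t columns.  Without rainbow cycles the
-- hypergraph is linear with distinct edges; if n < t ≤ q, n disjoint edges do.
-- Second inequality: t distinct edges of a hypergraph in G* colliding in every
-- part would make the parts into t edges of a loopless multigraph on t vertices;
-- such a multigraph has a cycle (delete leaves, then walk without backtracking
-- until a vertex repeats), and that cycle is a rainbow cycle.

open import Defs
open import Data.Nat using (ℕ; zero; suc; _≤_; _<_; _+_; s≤s)
import Data.Nat.Properties as ℕP
open import Data.Nat.DivMod using (_%_; n%n≡0; m<n⇒m%n≡m)
open import Data.Fin using (Fin; toℕ; fromℕ; fromℕ<; inject₁; inject≤; punchIn; punchOut; _≟_)
open import Data.Fin.Properties
  using (toℕ-fromℕ<; toℕ-fromℕ; toℕ-inject₁; toℕ-injective; toℕ<n; any?; all?; ¬∀⟶∃¬;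
         injective⇒≤; inject≤-injective; punchIn-punchOut; punchInᵢ≢i;
         punchIn-injective)
open import Data.Fin.Patterns using (0F; 1F)
open import Data.Vec.Functional using ([]; _∷_)
open import Data.Product using (Σ; ∃; ∃₂; _×_; _,_; proj₁; proj₂)
open import Data.Sum using (_⊎_; inj₁; inj₂)
open import Data.Empty using (⊥-elim)
open import Function using (_∘_; flip)
open import Function.Definitions using (Injective)
open import Relation.Nullary using (¬_; Dec; yes; no; contradiction)
open import Relation.Nullary.Decidable using (¬?; _×-dec_; _⊎-dec_; _→-dec_; decidable-stable)
open import Relation.Binary.Definitions using (tri<; tri≈; tri>)
open import Relation.Binary.PropositionalEquality using (_≡_; _≢_; refl; sym; trans; cong; subst; module ≡-Reasoning)

next-toℕ : ∀ {k} (i : Fin (suc k)) →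
  toℕ (next i) ≡ suc (toℕ i) ⊎ (toℕ i ≡ k × toℕ (next i) ≡ 0)
next-toℕ {k} i with ℕP.m≤n⇒m<n∨m≡n (toℕ<n i)
... | inj₁ i+1<k+1 = inj₁ (trans (toℕ-fromℕ< _) (m<n⇒m%n≡m i+1<k+1))
... | inj₂ i+1≡k+1 = inj₂ (ℕP.suc-injective i+1≡k+1 ,
        trans (toℕ-fromℕ< _) (trans (cong (_% suc k) i+1≡k+1) (n%n≡0 (suc k))))

next-injective : ∀ {k} → Injective _≡_ _≡_ (next {k})
next-injective {k} {i} {j} eq with next-toℕ i | next-toℕ j
... | inj₁ i′ | inj₁ j′ = toℕ-injective (ℕP.suc-injective (trans (sym i′) (trans (cong toℕ eq) j′)))
... | inj₂ (i≡k , _) | inj₂ (j≡k , _) = toℕ-injective (trans i≡k (sym j≡k))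
... | inj₁ i′ | inj₂ (_ , j′) with () ← trans (sym i′) (trans (cong toℕ eq) j′)
... | inj₂ (_ , i′) | inj₁ j′ with () ← trans (sym j′) (trans (cong toℕ (sym eq)) i′)

next-surjective : ∀ {k} (j : Fin (suc k)) → ∃ λ i → next i ≡ j
next-surjective {k} 0F with next-toℕ (fromℕ k)
... | inj₁ wraps = ⊥-elim (ℕP.<-irrefl (cong suc (toℕ-fromℕ k)) (subst (_< suc k) wraps (toℕ<n _)))
... | inj₂ (_ , to0) = fromℕ k , toℕ-injective to0
next-surjective {suc k} (Fin.suc j) with next-toℕ (inject₁ j)
... | inj₁ step = inject₁ j , toℕ-injective (trans step (cong suc (toℕ-inject₁ j)))
... | inj₂ (last , _) = ⊥-elim (ℕP.<-irrefl (trans (sym (toℕ-inject₁ j)) last) (toℕ<n j))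

next-irreflexive : ∀ {l} (i : Fin (suc (suc l))) → next i ≢ i
next-irreflexive i eq with next-toℕ i
... | inj₁ step = ℕP.1+n≢n (trans (sym step) (cong toℕ eq))
... | inj₂ (i≡l+1 , to0) with () ← trans (sym to0) (trans (cong toℕ eq) i≡l+1)

pair-injective : ∀ {A : Set} (f : Fin 2 → A) → f 0F ≢ f 1F → Injective _≡_ _≡_ f
pair-injective f ne {0F} {0F} _ = refl
pair-injective f ne {0F} {1F} eq = ⊥-elim (ne eq)
pair-injective f ne {1F} {0F} eq = ⊥-elim (ne (sym eq))
pair-injective f ne {1F} {1F} _ = refl

∷-injective : ∀ {k} {A : Set} {y : A} {c : Fin k → A} →
  Injective _≡_ _≡_ c → (∀ j → c j ≢ y) → Injective _≡_ _≡_ (y ∷ c)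
∷-injective c-inj fresh {0F} {0F} _ = refl
∷-injective c-inj fresh {0F} {Fin.suc j} eq = ⊥-elim (fresh j (sym eq))
∷-injective c-inj fresh {Fin.suc i} {0F} eq = ⊥-elim (fresh i eq)
∷-injective c-inj fresh {Fin.suc i} {Fin.suc j} eq = cong Fin.suc (c-inj eq)

-- A map Fin k → Fin n with k < n misses a value: were it onto, a choice of
-- preimages would be an injection Fin n → Fin k.
outsideImage : ∀ {k n} → k < n → (c : Fin k → Fin n) → ∃ λ y → ∀ j → c j ≢ y
outsideImage {k} {n} k<n c with any? (λ y → all? (λ j → ¬? (c j ≟ y)))
... | yes missed = missed
... | no ¬missed = contradiction (injective⇒≤ preimage-injective) (ℕP.<⇒≱ k<n)
  where
  preimage : ∀ y → ∃ λ j → c j ≡ y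
  preimage y = decidable-stable (any? λ j → c j ≟ y) λ ¬hit → ¬missed (y , λ j e → ¬hit (j , e))

  preimage-injective : Injective _≡_ _≡_ (proj₁ ∘ preimage)
  preimage-injective {x} {y} eq =
    trans (sym (proj₂ (preimage x))) (trans (cong c eq) (proj₂ (preimage y)))

injectiveCover : ∀ {n} k → k ≤ n → (g : Fin k → Fin n) →
  Σ (Fin k → Fin n) λ c → Injective _≡_ _≡_ c × (∀ r → ∃ λ j → c j ≡ g r)
injectiveCover zero _ g = (λ ()) , (λ {}) , λ ()
injectiveCover {n} (suc k) k<n g with injectiveCover k (ℕP.<⇒≤ k<n) (g ∘ Fin.suc)
... | c , c-inj , covers = y ∷ c , ∷-injective c-inj y-fresh , covers′
  where
  newValue : Σ (Fin n) λ y → (∀ j → c j ≢ y) × ∃ λ j → (y ∷ c) j ≡ g 0F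
  newValue with any? (λ j → c j ≟ g 0F)
  ... | yes (j , cj≡g0) = proj₁ (outsideImage k<n c) , proj₂ (outsideImage k<n c) , Fin.suc j , cj≡g0
  ... | no ¬covered = g 0F , (λ j e → ¬covered (j , e)) , 0F , refl

  y : Fin n
  y = proj₁ newValue

  y-fresh : ∀ j → c j ≢ y
  y-fresh = proj₁ (proj₂ newValue)

  covers′ : ∀ r → ∃ λ j → (y ∷ c) j ≡ g r
  covers′ 0F = proj₂ (proj₂ newValue)
  covers′ (Fin.suc r) = Fin.suc (proj₁ (covers r)) , proj₂ (covers r)

-- Two distinct edges sharing vertices from two different parts form a rainbow
-- 2-cycle; so a hypergraph without rainbow cycles is linear.
noRainbowCycle⇒linear : ∀ {r q m} (E : Hypergraph r q m) → ¬ HasRainbowCycle E → IsLinear E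
noRainbowCycle⇒linear E acyclic a b a≢b (i , x) (j , y) x∈a x∈b y∈a y∈b with i ≟ j
... | yes refl = cong (i ,_) (trans (sym x∈a) y∈a)
... | no i≢j = ⊥-elim (acyclic (0 , v , e , v-inj , e-inj , on-edges , rainbow))
  where
  v : Fin 2 → Vertex _ _
  v = (i , x) ∷ (j , y) ∷ []
  e : Fin 2 → Fin _
  e = a ∷ b ∷ []
  v-inj : Injective _≡_ _≡_ v
  v-inj = pair-injective v (i≢j ∘ cong proj₁)
  e-inj : Injective _≡_ _≡_ e
  e-inj = pair-injective e a≢b
  rainbow : Injective _≡_ _≡_ (proj₁ ∘ v)
  rainbow = pair-injective (proj₁ ∘ v) i≢j
  on-edges : ∀ k → (v k ∈E E (e k)) × (v (next k) ∈E E (e k))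
  on-edges 0F = x∈a , y∈a
  on-edges 1F = y∈b , x∈b

-- With at least two parts, linearity forces the edges to be distinct: equal
-- edges would share their vertices in parts 0 and 1.
linear⇒distinctEdges : ∀ {r q m} (E : Hypergraph (suc (suc r)) q m) → IsLinear E → IsHypergraph E
linear⇒distinctEdges E linear {a} {b} Ea≡Eb with a ≟ b
... | yes a≡b = a≡b
... | no a≢b with () ← cong proj₁ (linear a b a≢b (0F , E a 0F) (1F , E a 1F)
                     refl (cong (λ f → f 0F) (sym Ea≡Eb)) refl (cong (λ f → f 1F) (sym Ea≡Eb)))

noRainbowCycle⇒G* : ∀ {r q m} (E : Hypergraph (suc (suc r)) q m) → ¬ HasRainbowCycle E → IsG* E
noRainbowCycle⇒G* E acyclic = linear⇒distinctEdges E linear , linear , acyclic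
  where
  linear : IsLinear E
  linear = noRainbowCycle⇒linear E acyclic

-- If edges meet no common vertex in any part, there is no cycle at all:
-- consecutive edges of a cycle share the vertex between them.
disjointEdges⇒noRainbowCycle : ∀ {r q m} (E : Hypergraph r q m) →
  (∀ a b i → E a i ≡ E b i → a ≡ b) → ¬ HasRainbowCycle E
disjointEdges⇒noRainbowCycle E disjoint (l , v , e , _ , e-inj , on-edges , _) =
  next-irreflexive 0F (sym (e-inj (disjoint _ _ _ shared)))
  where
  shared : E (e 0F) (proj₁ (v (next 0F))) ≡ E (e (next 0F)) (proj₁ (v (next 0F)))
  shared = trans (proj₂ (on-edges 0F)) (sym (proj₁ (on-edges (next 0F))))

Collide : ∀ {N n q} → Matrix N n q → Fin N → Fin n → Fin n → Set
Collide M i x y = x ≢ y × M i x ≡ M i y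

collide? : ∀ {N n q} (M : Matrix N n q) i x y → Dec (Collide M i x y)
collide? M i x y = ¬? (x ≟ y) ×-dec (M i x ≟ M i y)

CollisionIn : ∀ {N n q k} → Matrix N n q → (Fin k → Fin n) → Fin N → Set
CollisionIn M f i = ∃₂ λ a b → Collide M i (f a) (f b)

collisionIn? : ∀ {N n q k} (M : Matrix N n q) (f : Fin k → Fin n) i → Dec (CollisionIn M f i)
collisionIn? M f i = any? λ a → any? λ b → collide? M i (f a) (f b)

-- A PHF separates any t columns even when listed with repetitions: some row has
-- no collision among them (apply the PHF property to t distinct columns covering them).
phf-separates : ∀ {N n q t} (M : Matrix N n q) → t ≤ n → IsPHF t M →
  (f : Fin t → Fin n) → ¬ (∀ i → CollisionIn M f i)
phf-separates {t = t} M t≤n phf f collisions =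
  let c , c-inj , covers = injectiveCover t t≤n f
      i , separated = phf c c-inj
      a , b , fa≢fb , agree = collisions i
      ja , ca≡fa = covers a
      jb , cb≡fb = covers b
  in fa≢fb (begin
       f a  ≡⟨ sym ca≡fa ⟩
       c ja ≡⟨ cong c (separated (trans (cong (M i) ca≡fa) (trans agree (sym (cong (M i) cb≡fb))))) ⟩
       c jb ≡⟨ cb≡fb ⟩
       f b  ∎)
  where open ≡-Reasoning

NoUniqueCoord : ∀ {N n q} → Matrix N n q → Set
NoUniqueCoord {N} {n} M = ¬ (Σ (Fin n) λ x → Σ (Fin N) λ i → UniqueCoord M x i)

partner : ∀ {N n q} (M : Matrix N n q) → NoUniqueCoord M → ∀ x i → ∃ λ y → Collide M i y x
partner M noUnique x i with any? (λ y → collide? M i y x)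
... | yes found = found
... | no ¬found = ⊥-elim (noUnique (x , i , λ y y≢x eq → ¬found (y , y≢x , eq)))

columnHypergraph : ∀ {t n q} → Matrix t n q → Hypergraph t q n
columnHypergraph = flip

-- A rainbow cycle among the columns of a matrix without unique coordinates
-- yields one column per row that collide in every row: a row met by the cycle
-- in v j is answered by the two cycle edges through v j, any other row by e 0
-- and a partner of it.
rainbowCycle⇒collisions : ∀ {t n q} (M : Matrix t n q) → NoUniqueCoord M →
  HasRainbowCycle (columnHypergraph M) →
  Σ (Fin t → Fin n) λ f → ∀ i → CollisionIn M f i
rainbowCycle⇒collisions {t} {n} M noUnique (l , v , e , _ , e-inj , on-edges , rainbow) =
  f , collisions
  where
  open ≡-Reasoning

  part : Fin (suc (suc l)) → Fin t
  part = proj₁ ∘ v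

  choice : (r : Fin t) → Σ (Fin n) λ y →
    (∀ j → part j ≡ r → y ≡ e j) × (¬ (∃ λ j → part j ≡ r) → Collide M r y (e 0F))
  choice r with any? (λ j → part j ≟ r)
  ... | yes (j , pj≡r) =
    e j , (λ j′ pj′≡r → cong e (rainbow (trans pj≡r (sym pj′≡r)))) , λ missed → ⊥-elim (missed (j , pj≡r))
  ... | no missed = proj₁ (partner M noUnique (e 0F) r) ,
    (λ j pj≡r → ⊥-elim (missed (j , pj≡r))) , λ _ → proj₂ (partner M noUnique (e 0F) r)

  f : Fin t → Fin n
  f r = proj₁ (choice r)

  f-on-cycle : ∀ j → f (part j) ≡ e j
  f-on-cycle j = proj₁ (proj₂ (choice (part j))) j refl

  collisions : ∀ r → CollisionIn M f r
  collisions r with any? (λ j → part j ≟ r)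
  ... | yes (j , refl) = part j′ , part j , distinct , agree
    where
    j′ : Fin (suc (suc l))
    j′ = proj₁ (next-surjective j)

    j′↦j : next j′ ≡ j
    j′↦j = proj₂ (next-surjective j)

    distinct : f (part j′) ≢ f (part j)
    distinct eq = next-irreflexive j′
      (trans j′↦j (sym (e-inj (trans (sym (f-on-cycle j′)) (trans eq (f-on-cycle j))))))

    agree : M (part j) (f (part j′)) ≡ M (part j) (f (part j))
    agree = begin
      M (part j) (f (part j′)) ≡⟨ cong (M (part j)) (f-on-cycle j′) ⟩
      M (part j) (e j′)        ≡⟨ subst (λ k → v k ∈E columnHypergraph M (e j′)) j′↦j (proj₂ (on-edges j′)) ⟩
      proj₂ (v j)              ≡⟨ sym (proj₁ (on-edges j)) ⟩
      M (part j) (e j)         ≡⟨ cong (M (part j)) (f-on-cycle j) ⟨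
      M (part j) (f (part j))  ∎
  ... | no missed = r , part 0F , subst (Collide M r (f r)) (sym (f-on-cycle 0F))
                                    (proj₂ (proj₂ (choice r)) missed)

phf*⇒noRainbowCycle : ∀ {t n q} (M : Matrix t n q) → t ≤ n → IsPHF* t M →
  ¬ HasRainbowCycle (columnHypergraph M)
phf*⇒noRainbowCycle M t≤n (phf , noUnique) cycle =
  let f , collisions = rainbowCycle⇒collisions M noUnique cycle
  in phf-separates M t≤n phf f collisions

diagonalHypergraph : ∀ {r q n} → n ≤ q → Hypergraph r q n
diagonalHypergraph n≤q a _ = inject≤ a n≤q

-- A PHF*(t; n, q, t) with 2 ≤ t ≤ q gives a hypergraph in G* with n edges: its
-- columns if t ≤ n, and otherwise (n < t ≤ q) the diagonal hypergraph, whose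
-- edges are pairwise disjoint.
phf*⇒G* : ∀ {t′ n q} → suc (suc t′) ≤ q → (M : Matrix (suc (suc t′)) n q) →
  IsPHF* (suc (suc t′)) M → Σ (Hypergraph (suc (suc t′)) q n) IsG*
phf*⇒G* {t′} {n} {q} t≤q M phf* with suc (suc t′) ℕP.≤? n
... | yes t≤n = columnHypergraph M , noRainbowCycle⇒G* _ (phf*⇒noRainbowCycle M t≤n phf*)
... | no t≰n = diagonalHypergraph n≤q , noRainbowCycle⇒G* _ (disjointEdges⇒noRainbowCycle _ disjoint)
  where
  n≤q : n ≤ q
  n≤q = ℕP.≤-trans (ℕP.<⇒≤ (ℕP.≰⇒> t≰n)) t≤q

  disjoint : ∀ a b i → diagonalHypergraph n≤q a i ≡ diagonalHypergraph n≤q b i → a ≡ b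
  disjoint a b _ = inject≤-injective n≤q n≤q a b

InjectiveBelow : ∀ {A : Set} → (ℕ → A) → ℕ → Set
InjectiveBelow W b = ∀ {x y} → x < b → y < b → W x ≡ W y → x ≡ y

FirstRepetition : ∀ {A : Set} → (ℕ → A) → Set
FirstRepetition W = ∃₂ λ a d → W a ≡ W (a + suc d) × InjectiveBelow W (a + suc d)

scan : ∀ {V} (W : ℕ → Fin V) n → InjectiveBelow W n ⊎ FirstRepetition W
scan W zero = inj₁ (λ ())
scan W (suc n) with scan W n
... | inj₂ repetition = inj₂ repetition
... | inj₁ distinct with any? (λ (a : Fin n) → W (toℕ a) ≟ W n)
...   | yes (a , Wa≡Wn) =
  inj₂ (toℕ a , d , subst (λ b → W (toℕ a) ≡ W b × InjectiveBelow W b) n≡a+1+d (Wa≡Wn , distinct))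
  where
  d : ℕ
  d = proj₁ (ℕP.m≤n⇒∃[o]m+o≡n (toℕ<n a))

  n≡a+1+d : n ≡ toℕ a + suc d
  n≡a+1+d = trans (sym (proj₂ (ℕP.m≤n⇒∃[o]m+o≡n (toℕ<n a)))) (sym (ℕP.+-suc (toℕ a) d))
...   | no new = inj₁ distinct′
  where
  distinct′ : InjectiveBelow W (suc n)
  distinct′ (s≤s x≤n) (s≤s y≤n) eq with ℕP.m≤n⇒m<n∨m≡n x≤n | ℕP.m≤n⇒m<n∨m≡n y≤n
  ... | inj₁ x<n | inj₁ y<n = distinct x<n y<n eq
  ... | inj₁ x<n | inj₂ refl = ⊥-elim (new (fromℕ< x<n , trans (cong W (toℕ-fromℕ< x<n)) eq))
  ... | inj₂ refl | inj₁ y<n = ⊥-elim (new (fromℕ< y<n , trans (cong W (toℕ-fromℕ< y<n)) (sym eq)))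
  ... | inj₂ refl | inj₂ refl = refl

firstRepetition : ∀ {V} (W : ℕ → Fin V) → FirstRepetition W
firstRepetition {V} W with scan W (suc V)
... | inj₂ repetition = repetition
... | inj₁ distinct =
  contradiction (injective⇒≤ (λ eq → toℕ-injective (distinct (toℕ<n _) (toℕ<n _) eq))) ℕP.1+n≰n

closed-next : ∀ {A : Set} (W : ℕ → A) a {l} → W a ≡ W (a + suc (suc l)) →
  (i : Fin (suc (suc l))) → W (suc (a + toℕ i)) ≡ W (a + toℕ (next i))
closed-next W a {l} returns i with next-toℕ i
... | inj₁ step = cong W (begin
  suc (a + toℕ i)   ≡⟨ ℕP.+-suc a (toℕ i) ⟨
  a + suc (toℕ i)   ≡⟨ cong (a +_) step ⟨
  a + toℕ (next i)  ∎)
  where open ≡-Reasoning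
... | inj₂ (last , wraps) = begin
  W (suc (a + toℕ i))    ≡⟨ cong W (ℕP.+-suc a (toℕ i)) ⟨
  W (a + suc (toℕ i))    ≡⟨ cong (λ k → W (a + suc k)) last ⟩
  W (a + suc (suc l))    ≡⟨ returns ⟨
  W a                    ≡⟨ cong W (ℕP.+-identityʳ a) ⟨
  W (a + 0)              ≡⟨ cong (λ k → W (a + k)) wraps ⟨
  W (a + toℕ (next i))   ∎
  where open ≡-Reasoning

-- A multigraph with vertices Fin V and edges Fin R, edge r having ends α r and β r.
module Multigraph {V R : ℕ} (α β : Fin R → Fin V) where

  Joins : Fin R → Fin V → Fin V → Set
  Joins r x y = (α r ≡ x × β r ≡ y) ⊎ (α r ≡ y × β r ≡ x)

  Incident : Fin R → Fin V → Set
  Incident r x = α r ≡ x ⊎ β r ≡ x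

  incident? : ∀ r x → Dec (Incident r x)
  incident? r x = (α r ≟ x) ⊎-dec (β r ≟ x)

  Loopless : Set
  Loopless = ∀ r → α r ≢ β r

  Cycle : Set
  Cycle = Σ ℕ λ l → Σ (Fin (suc (suc l)) → Fin V) λ u → Σ (Fin (suc (suc l)) → Fin R) λ r →
    Injective _≡_ _≡_ u × Injective _≡_ _≡_ r × (∀ i → Joins (r i) (u i) (u (next i)))

  otherEnd : ∀ {r x} → Incident r x → ∃ λ y → Joins r x y
  otherEnd {r} (inj₁ αr≡x) = β r , inj₁ (αr≡x , refl)
  otherEnd {r} (inj₂ βr≡x) = α r , inj₂ (refl , βr≡x)

  joins⇒incident : ∀ {r x y} → Joins r x y → Incident r y
  joins⇒incident (inj₁ (_ , βr≡y)) = inj₂ βr≡y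
  joins⇒incident (inj₂ (αr≡y , _)) = inj₁ αr≡y

  joins-distinct : Loopless → ∀ {r x y} → Joins r x y → x ≢ y
  joins-distinct loopless {r} (inj₁ (refl , refl)) = loopless r
  joins-distinct loopless {r} (inj₂ (refl , refl)) = loopless r ∘ sym

  joins-unique : ∀ {r x y x′ y′} → Joins r x y → Joins r x′ y′ →
    (x ≡ x′ × y ≡ y′) ⊎ (x ≡ y′ × y ≡ x′)
  joins-unique (inj₁ (refl , refl)) (inj₁ (refl , refl)) = inj₁ (refl , refl)
  joins-unique (inj₁ (refl , refl)) (inj₂ (refl , refl)) = inj₂ (refl , refl)
  joins-unique (inj₂ (refl , refl)) (inj₁ (refl , refl)) = inj₂ (refl , refl)
  joins-unique (inj₂ (refl , refl)) (inj₂ (refl , refl)) = inj₁ (refl , refl)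

  -- An infinite walk that never leaves a vertex along the edge it arrived by:
  -- the edge `edge (suc n)` leads from `vertex n` to `vertex (suc n)`.
  record Walk : Set where
    field
      vertex : ℕ → Fin V
      edge : ℕ → Fin R
      steps : ∀ n → Joins (edge (suc n)) (vertex n) (vertex (suc n))
      nonBacktracking : ∀ n → edge (suc n) ≢ edge n

  Continues : Fin V → Fin R → Set
  Continues x r = Incident r x → ∃ λ r′ → r′ ≢ r × Incident r′ x

  continues? : ∀ x r → Dec (Continues x r)
  continues? x r = incident? r x →-dec any? λ r′ → ¬? (r′ ≟ r) ×-dec incident? r′ x

  NoLeaf : Set
  NoLeaf = ∀ x r → Continues x r

  noLeaf⇒walk : NoLeaf → Fin R → Walk
  noLeaf⇒walk noLeaf r₀ = record
    { vertex = proj₁ ∘ position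
    ; edge = proj₁ ∘ proj₂ ∘ position
    ; steps = λ n → move-joins (position n)
    ; nonBacktracking = λ n → move-new (position n)
    }
    where
    State : Set
    State = Σ (Fin V) λ x → Σ (Fin R) λ r → Incident r x

    continue : (s : State) → ∃ λ r′ → r′ ≢ proj₁ (proj₂ s) × Incident r′ (proj₁ s)
    continue (x , r , r∋x) = noLeaf x r r∋x

    move : State → State
    move s = proj₁ (otherEnd (proj₂ (proj₂ (continue s)))) , proj₁ (continue s) ,
             joins⇒incident (proj₂ (otherEnd (proj₂ (proj₂ (continue s)))))

    move-joins : ∀ s → Joins (proj₁ (proj₂ (move s))) (proj₁ s) (proj₁ (move s))
    move-joins s = proj₂ (otherEnd (proj₂ (proj₂ (continue s))))

    move-new : ∀ s → proj₁ (proj₂ (move s)) ≢ proj₁ (proj₂ s)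
    move-new s = proj₁ (proj₂ (continue s))

    position : ℕ → State
    position zero = α r₀ , r₀ , inj₁ refl
    position (suc n) = move (position n)

  module _ (walk : Walk) where
    open Walk walk

    -- While its vertices are distinct, the walk uses distinct edges: a repeated
    -- edge would be traversed again from the same vertex, or immediately backwards.
    walk-edges-distinct : ∀ {b} → InjectiveBelow vertex b →
      ∀ {x y} → x < y → y < b → edge (suc x) ≢ edge (suc y)
    walk-edges-distinct distinct {x} {y} x<y y<b same
      with joins-unique (steps x) (subst (λ r → Joins r (vertex y) (vertex (suc y))) (sym same) (steps y))
    ... | inj₁ (Wx≡Wy , _) = ℕP.<⇒≢ x<y (distinct (ℕP.<-trans x<y y<b) y<b Wx≡Wy)
    ... | inj₂ (_ , Wx+1≡Wy) with distinct (ℕP.≤-<-trans x<y y<b) y<b Wx+1≡Wy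
    ...   | refl = nonBacktracking (suc x) (sym same)

    walk-edges-injectiveBelow : ∀ {b} → InjectiveBelow vertex b → InjectiveBelow (edge ∘ suc) b
    walk-edges-injectiveBelow distinct {x} {y} x<b y<b same with ℕP.<-cmp x y
    ... | tri< x<y _ _ = ⊥-elim (walk-edges-distinct distinct x<y y<b same)
    ... | tri≈ _ x≡y _ = x≡y
    ... | tri> _ _ y<x = ⊥-elim (walk-edges-distinct distinct y<x x<b (sym same))

    walk⇒cycle : Loopless → Cycle
    walk⇒cycle loopless with firstRepetition vertex
    ... | a , zero , returns , _ =
      ⊥-elim (joins-distinct loopless (steps a) (trans returns (cong vertex (ℕP.+-comm a 1))))
    ... | a , suc l , returns , distinct = l , u , r , u-inj , r-inj , λ i →
      subst (Joins (r i) (u i)) (closed-next vertex a returns i) (steps (a + toℕ i))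
      where
      bound : (i : Fin (suc (suc l))) → a + toℕ i < a + suc (suc l)
      bound i = ℕP.+-monoʳ-< a (toℕ<n i)

      u : Fin (suc (suc l)) → Fin V
      u i = vertex (a + toℕ i)

      r : Fin (suc (suc l)) → Fin R
      r i = edge (suc (a + toℕ i))

      u-inj : Injective _≡_ _≡_ u
      u-inj {i} {j} eq = toℕ-injective (ℕP.+-cancelˡ-≡ a _ _ (distinct (bound i) (bound j) eq))

      r-inj : Injective _≡_ _≡_ r
      r-inj {i} {j} eq =
        toℕ-injective (ℕP.+-cancelˡ-≡ a _ _ (walk-edges-injectiveBelow distinct (bound i) (bound j) eq))

  leafOrNoLeaf : NoLeaf ⊎ ∃₂ λ x r₀ → ∀ r → r ≢ r₀ → ¬ Incident r x
  leafOrNoLeaf with all? (λ x → all? (continues? x))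
  ... | yes noLeaf = inj₁ noLeaf
  ... | no ¬noLeaf =
    let x , ¬atX = ¬∀⟶∃¬ _ _ (λ x → all? (continues? x)) ¬noLeaf
        r₀ , stuck = ¬∀⟶∃¬ _ _ (continues? x) ¬atX
    in inj₂ (x , r₀ , λ r r≢r₀ r∋x → stuck (λ _ → r , r≢r₀ , r∋x))

cycle-embed : ∀ {V V′ R R′} {α β : Fin R → Fin V} {α′ β′ : Fin R′ → Fin V′}
  (σ : Fin V′ → Fin V) (ρ : Fin R′ → Fin R) → Injective _≡_ _≡_ σ → Injective _≡_ _≡_ ρ →
  (∀ r → α (ρ r) ≡ σ (α′ r)) → (∀ r → β (ρ r) ≡ σ (β′ r)) →
  Multigraph.Cycle α′ β′ → Multigraph.Cycle α β
cycle-embed {α = α} {β} {α′} {β′} σ ρ σ-inj ρ-inj α-comm β-comm (l , u , r , u-inj , r-inj , joins) =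
  l , σ ∘ u , ρ ∘ r , (λ eq → u-inj (σ-inj eq)) , (λ eq → r-inj (ρ-inj eq)) , λ i → embed (joins i)
  where
  embed : ∀ {e x y} → Multigraph.Joins α′ β′ e x y → Multigraph.Joins α β (ρ e) (σ x) (σ y)
  embed {e} (inj₁ (refl , refl)) = inj₁ (α-comm e , β-comm e)
  embed {e} (inj₂ (refl , refl)) = inj₂ (α-comm e , β-comm e)

deleteLeaf : ∀ {V R} (α β : Fin (suc R) → Fin (suc V)) (x : Fin (suc V)) (r₀ : Fin (suc R)) →
  (∀ r → r ≢ r₀ → ¬ Multigraph.Incident α β r x) →
  Σ (Fin R → Fin V) λ α′ → Σ (Fin R → Fin V) λ β′ →
    (∀ r → α (punchIn r₀ r) ≡ punchIn x (α′ r)) × (∀ r → β (punchIn r₀ r) ≡ punchIn x (β′ r))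
deleteLeaf α β x r₀ isolated =
  (λ r → punchOut (x≢α r)) , (λ r → punchOut (x≢β r)) ,
  (λ r → sym (punchIn-punchOut (x≢α r))) , (λ r → sym (punchIn-punchOut (x≢β r)))
  where
  x≢α : ∀ r → x ≢ α (punchIn r₀ r)
  x≢α r eq = isolated (punchIn r₀ r) (punchInᵢ≢i r₀ r) (inj₁ (sym eq))

  x≢β : ∀ r → x ≢ β (punchIn r₀ r)
  x≢β r eq = isolated (punchIn r₀ r) (punchInᵢ≢i r₀ r) (inj₂ (sym eq))

-- A loopless multigraph with as many edges as vertices contains a cycle: delete
-- leaves (which keeps the two counts equal) until there are none, then walk.
loopless⇒cycle : ∀ k (α β : Fin (suc k) → Fin (suc k)) →
  Multigraph.Loopless α β → Multigraph.Cycle α β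
loopless⇒cycle zero α β loopless with α 0F | β 0F | loopless 0F
... | 0F | 0F | loop = ⊥-elim (loop refl)
loopless⇒cycle (suc k) α β loopless with Multigraph.leafOrNoLeaf α β
... | inj₁ noLeaf = Multigraph.walk⇒cycle α β (Multigraph.noLeaf⇒walk α β noLeaf 0F) loopless
... | inj₂ (x , r₀ , isolated) =
  let α′ , β′ , α-comm , β-comm = deleteLeaf α β x r₀ isolated
      loopless′ : Multigraph.Loopless α′ β′
      loopless′ r eq =
        loopless (punchIn r₀ r) (trans (α-comm r) (trans (cong (punchIn x) eq) (sym (β-comm r))))
  in cycle-embed {α = α} {β} (punchIn x) (punchIn r₀) (punchIn-injective x _ _) (punchIn-injective r₀ _ _)
       α-comm β-comm (loopless⇒cycle k α′ β′ loopless′)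

edgeMatrix : ∀ {t q m} → Hypergraph t q m → Matrix t m q
edgeMatrix = flip

-- Given edges c x (x : Fin t), let part i join x and y when c x and c y meet in
-- part i.  A cycle of this collision multigraph is a rainbow cycle of E, since
-- its multigraph edges are distinct parts.
collisionCycle⇒rainbowCycle : ∀ {t q m} (E : Hypergraph t q m) (c : Fin t → Fin m) →
  Injective _≡_ _≡_ c → (α β : Fin t → Fin t) → (∀ i → E (c (α i)) i ≡ E (c (β i)) i) →
  Multigraph.Cycle α β → HasRainbowCycle E
collisionCycle⇒rainbowCycle {t} {q} {m} E c c-inj α β meet (l , u , r , u-inj , r-inj , joins) =
  l , v , e , (λ eq → r-inj (cong proj₁ eq)) , (λ eq → next-injective (u-inj (c-inj eq))) ,
  (λ i → sym (shared (joins i)) , refl) , r-inj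
  where
  -- v i is the common vertex, in part r i, of the edges c (u i) and c (u (next i));
  -- so e i = c (u (next i)) contains v i and v (next i)
  v : Fin (suc (suc l)) → Vertex t q
  v i = r i , E (c (u i)) (r i)

  e : Fin (suc (suc l)) → Fin m
  e i = c (u (next i))

  shared : ∀ {i x y} → Multigraph.Joins α β i x y → E (c x) i ≡ E (c y) i
  shared {i} (inj₁ (refl , refl)) = meet i
  shared {i} (inj₂ (refl , refl)) = sym (meet i)

-- Without rainbow cycles the edge matrix is a PHF: t distinct edges meeting
-- pairwise in every part would make a loopless collision multigraph with t
-- vertices and t edges, hence with a cycle.
noRainbowCycle⇒phf : ∀ {t′ q m} (E : Hypergraph (suc t′) q m) → ¬ HasRainbowCycle E →
  IsPHF (suc t′) (edgeMatrix E)
noRainbowCycle⇒phf {t′} E acyclic c c-inj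
  with all? (collisionIn? (edgeMatrix E) c)
... | yes collisions = ⊥-elim (acyclic (collisionCycle⇒rainbowCycle E c c-inj α β meet
                          (loopless⇒cycle t′ α β loopless)))
  where
  α β : Fin (suc t′) → Fin (suc t′)
  α i = proj₁ (collisions i)
  β i = proj₁ (proj₂ (collisions i))

  loopless : Multigraph.Loopless α β
  loopless i = proj₁ (proj₂ (proj₂ (collisions i))) ∘ cong c

  meet : ∀ i → E (c (α i)) i ≡ E (c (β i)) i
  meet i = proj₂ (proj₂ (proj₂ (collisions i)))
... | no ¬collisions =
  let i , noCollision = ¬∀⟶∃¬ _ _ (collisionIn? (edgeMatrix E) c) ¬collisions
  in i , λ {x} {y} eq → decidable-stable (x ≟ y) λ x≢y → noCollision (x , y , x≢y ∘ c-inj , eq)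

lemma6p1 : (t q : ℕ) → 2 ≤ t → t ≤ q →
    ((n : ℕ) → Σ (Matrix t n q) (IsPHF* t) →
      Σ ℕ λ m → Σ (Hypergraph t q m) IsG* × n ≤ m)
    × ((m : ℕ) → Σ (Hypergraph t q m) IsG* →
      Σ ℕ λ n → Σ (Matrix t n q) (IsPHF t) × m ≤ n)
lemma6p1 (suc zero) _ (s≤s ()) _
lemma6p1 (suc (suc t′)) q _ t≤q = phf*⇒hypergraph , hypergraph⇒phf
  where
  phf*⇒hypergraph : (n : ℕ) → Σ (Matrix (suc (suc t′)) n q) (IsPHF* (suc (suc t′))) →
    Σ ℕ λ m → Σ (Hypergraph (suc (suc t′)) q m) IsG* × n ≤ m
  phf*⇒hypergraph n (M , phf*) = n , phf*⇒G* t≤q M phf* , ℕP.≤-refl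

  hypergraph⇒phf : (m : ℕ) → Σ (Hypergraph (suc (suc t′)) q m) IsG* →
    Σ ℕ λ n → Σ (Matrix (suc (suc t′)) n q) (IsPHF (suc (suc t′))) × m ≤ n
  hypergraph⇒phf m (E , _ , _ , acyclic) = m , (edgeMatrix E , noRainbowCycle⇒phf E acyclic) , ℕP.≤-refl
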